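{- For every positive integer $t$, $\mathrm{BDIS}_t$ is as hard as $\mathrm{ASG}_t$ with respect to $(\mu_0,\mu_1)$: for all $\alpha,\beta,\gamma$, if there exists an $(\alpha,\beta,\gamma)$-competitive Pareto-optimal algorithm for $\mathrm{BDIS}_t$, then there exists an $(\alpha,\beta,\gamma)$-competitive algorithm for $\mathrm{ASG}_t$.
   Context: Online problems with binary predictions: an instance is $I=(x,\hat x,r)$, $r=(r_1,\dots,r_n)$ requests, $x,\hat x\in\{0,1\}^n$; requests are revealed one at a time, with $r_i$ the deterministic online algorithm receives prediction $\hat x_i$ and must irrevocably output $y_i\in\{0,1\}$ before the next request; the unrevealed $x$ encodes an optimal solution. $\mathrm{Alg}(I),\mathrm{Opt}(I)$ denote profits (maximization) or costs (minimization). $\mu_0(I)=\sum_i x_i(1-\hat x_i)$, $\mu_1(I)=\sum_i(1-x_i)\hat x_i$. For $\alpha,\beta,\gamma\ge0$, an algorithm is $(\alpha,\beta,\gamma)$-competitive (w.r.t. $(\mu_0,\mu_1)$) if there is a constant $b$ with $\mathrm{Opt}(I)\le\alpha\mathrm{Alg}(I)+\beta\mu_0(I)+\gamma\mu_1(I)+b$ for all $I$ (maximization), resp. $\mathrm{Alg}(I)\le\alpha\mathrm{Opt}(I)+\beta\mu_0(I)+\gamma\mu_1(I)+b$ for all $I$ (minimization). It is Pareto-optimal if for no $\varepsilon>0$ is there an $(\alpha-\varepsilon,\beta,\gamma)$-, $(\alpha,\beta-\varepsilon,\gamma)$- or $(\alpha,\beta,\gamma-\varepsilon)$-competitive algorithm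 for the same problem. $\mathrm{ASG}_t$: request $r_i$ prompts a guess $y_i$ of bit $x_i$ given $\hat x_i$; after all guesses $x$ is revealed; cost $\sum_i(y_i+t\,x_i(1-y_i))$, minimized; $\mathrm{Opt}(I)=\sum_ix_i$. $\mathrm{BDIS}_t$: vertex-arrival (request $r_i$ is a new vertex $v_i$ with all edges of the input graph $G$ to $v_1,\dots,v_{i-1}$), $G$ has maximum degree at most $t$; $y_i=0$ accepts $v_i$; $\{v_i:x_i=0\}$ is a maximum independent set; profit $\sum_i(1-y_i)$ if accepted vertices are independent, else $-\infty$; maximized.
   Formalization: The parameters α, β, γ range over the nonnegative rationals instead of [0,∞), and the ε in Pareto-optimality and the additive constant b are rational as well. -}

module Defs where

open import Data.Bool using (Bool; true; false; not; _∧_; _∨_; if_then_else_)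
open import Data.Nat as ℕ using (ℕ; zero; suc; _≡ᵇ_)
open import Data.Integer using (+_)
open import Data.List using (List; []; _∷_; _++_; [_]; length; map; upTo; zip)
open import Data.Nat.ListAction using (sum)
open import Data.Bool.ListAction using (any)
open import Data.Product using (Σ; ∃; _×_; _,_; proj₁; proj₂)
open import Data.Unit using (⊤)
open import Data.Empty using (⊥)
open import Data.Sum using (_⊎_)
open import Relation.Nullary using (¬_)
open import Relation.Binary.PropositionalEquality using (_≡_)
open import Data.Rational as ℚ using (ℚ; 0ℚ; _/_)

-- A deterministic online algorithm with request type R
-- is a function from the history seen so far (requests and predictions
-- r_1 , x̂_1 , … , r_i , x̂_i, the current one last) to its output y_i.
-- (Its own previous outputs are a function of this history, and it never
-- sees x nor the length n.)

OnlineAlg : Set → Set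
OnlineAlg R = List (R × Bool) → Bool

Instance : Set → Set
Instance R = List (R × Bool × Bool)   -- (r_i , x̂_i , x_i)

inputs : {R : Set} → Instance R → List (R × Bool)
inputs = map (λ t → proj₁ t , proj₁ (proj₂ t))

requests : {R : Set} → Instance R → List R
requests = map proj₁

predictions : {R : Set} → Instance R → List Bool
predictions = map (λ t → proj₁ (proj₂ t))

truth : {R : Set} → Instance R → List Bool
truth = map (λ t → proj₂ (proj₂ t))

runFrom : {R : Set} → OnlineAlg R → List (R × Bool) → List (R × Bool) → List Bool
runFrom A hist []       = []
runFrom A hist (p ∷ ps) = A (hist ++ [ p ]) ∷ runFrom A (hist ++ [ p ]) ps

run : {R : Set} → OnlineAlg R → Instance R → List Bool
run A I = runFrom A [] (inputs I)

bit : Bool → ℕ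
bit b = if b then 1 else 0

ones : List Bool → ℕ
ones bs = sum (map bit bs)

zeros : List Bool → ℕ
zeros bs = sum (map (λ b → bit (not b)) bs)

μ₀ : {R : Set} → Instance R → ℕ
μ₀ I = sum (map (λ t → bit (proj₂ (proj₂ t) ∧ not (proj₁ (proj₂ t)))) I)

μ₁ : {R : Set} → Instance R → ℕ
μ₁ I = sum (map (λ t → bit (not (proj₂ (proj₂ t)) ∧ proj₁ (proj₂ t))) I)

⟦_⟧ : ℕ → ℚ
⟦ n ⟧ = + n / 1

NonNeg3 : ℚ → ℚ → ℚ → Set
NonNeg3 α β γ = (0ℚ ℚ.≤ α) × (0ℚ ℚ.≤ β) × (0ℚ ℚ.≤ γ)

-- ASG_t : requests carry no information (R = ⊤); every x is admissible.
-- cost = Σ (y_i + t x_i (1 - y_i)),  Opt = Σ x_i.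

ASGcost : ℕ → List Bool → List Bool → ℕ
ASGcost t xs ys =
  sum (map (λ p → bit (proj₂ p) ℕ.+ t ℕ.* bit (proj₁ p ∧ not (proj₂ p))) (zip xs ys))

ASG-Competitive : ℕ → ℚ → ℚ → ℚ → OnlineAlg ⊤ → Set
ASG-Competitive t α β γ A =
  NonNeg3 α β γ ×
  ∃ λ (b : ℚ) → (I : Instance ⊤) →
    ⟦ ASGcost t (truth I) (run A I) ⟧
      ℚ.≤ α ℚ.* ⟦ ones (truth I) ⟧ ℚ.+ β ℚ.* ⟦ μ₀ I ⟧ ℚ.+ γ ℚ.* ⟦ μ₁ I ⟧ ℚ.+ b

-- BDIS_t : vertex arrival.  Vertices are numbered 0,1,…,n-1 in arrival
-- order; the request r_i of vertex i is the list of (indices of) its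
-- neighbours among the earlier vertices 0,…,i-1.

nth : {A : Set} → A → List A → ℕ → A
nth d []       _       = d
nth d (a ∷ as) zero    = a
nth d (a ∷ as) (suc i) = nth d as i

memᵇ : ℕ → List ℕ → Bool
memᵇ j l = any (λ k → k ≡ᵇ j) l

adj : List (List ℕ) → ℕ → ℕ → Bool
adj rs i j = memᵇ j (nth [] rs i) ∨ memᵇ i (nth [] rs j)

WellFormed : List (List ℕ) → Set
WellFormed rs = ∀ i j → i ℕ.< length rs → memᵇ j (nth [] rs i) ≡ true → j ℕ.< i

countᵇ : (ℕ → Bool) → List ℕ → ℕ
countᵇ p l = sum (map (λ j → bit (p j)) l)

degree : List (List ℕ) → ℕ → ℕ
degree rs i = countᵇ (adj rs i) (upTo (length rs))

MaxDegreeAtMost : ℕ → List (List ℕ) → Set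
MaxDegreeAtMost t rs = ∀ i → i ℕ.< length rs → degree rs i ℕ.≤ t

IndependentZeros : List (List ℕ) → List Bool → Set
IndependentZeros rs z =
  ∀ i j → i ℕ.< length rs → j ℕ.< length rs →
    nth true z i ≡ false → nth true z j ≡ false → adj rs i j ≡ false

MaxIndependentZeros : List (List ℕ) → List Bool → Set
MaxIndependentZeros rs x =
  IndependentZeros rs x ×
  ((z : List Bool) → length z ≡ length rs → IndependentZeros rs z → zeros z ℕ.≤ zeros x)

ValidBDIS : ℕ → Instance (List ℕ) → Set
ValidBDIS t I =
  WellFormed (requests I) × MaxDegreeAtMost t (requests I) ×
  MaxIndependentZeros (requests I) (truth I)

-- Profit is the number of accepted
-- vertices (y_i = 0) if they form an independent set, and -∞ otherwise;
-- the inequality Opt ≤ α Alg + … + b can only hold with finite profit,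
-- so competitiveness demands independence on every valid instance.
BDIS-Competitive : ℕ → ℚ → ℚ → ℚ → OnlineAlg (List ℕ) → Set
BDIS-Competitive t α β γ A =
  NonNeg3 α β γ ×
  ∃ λ (b : ℚ) → (I : Instance (List ℕ)) → ValidBDIS t I →
    IndependentZeros (requests I) (run A I) ×
    (⟦ zeros (truth I) ⟧
      ℚ.≤ α ℚ.* ⟦ zeros (run A I) ⟧ ℚ.+ β ℚ.* ⟦ μ₀ I ⟧ ℚ.+ γ ℚ.* ⟦ μ₁ I ⟧ ℚ.+ b)

BDIS-ParetoOptimal : ℕ → ℚ → ℚ → ℚ → Set
BDIS-ParetoOptimal t α β γ =
  ¬ (Σ ℚ λ ε → 0ℚ ℚ.< ε × Σ (OnlineAlg (List ℕ)) λ A' →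
       BDIS-Competitive t (α ℚ.- ε) β γ A' ⊎
       BDIS-Competitive t α (β ℚ.- ε) γ A' ⊎
       BDIS-Competitive t α β (γ ℚ.- ε) A')

-- An ASG_t algorithm is obtained by simulating a competitive BDIS_t algorithm A on a forest of
-- stars: every request predicted 1 becomes a star centre, and all centres arrive before any
-- leaf, so A answers them online.  Only afterwards does a star receive its leaves, chosen from
-- the true bit x and A's answer y: x leaves if A rejected the centre (y = 1), t if it accepted.
-- Each star then has as BDIS Opt, Alg and prediction errors exactly the ASG Alg, Opt and errors
-- of its request, except when A accepted a centre with x = 0, a loss that α ≤ t covers.
-- Requests predicted 0 are guessed 0; this is affordable because competitiveness on forests
-- predicted 0, with 0 or t leaves per star chosen against A's answers, already forces
-- t ≤ α + β.  When t ≤ α, always guessing 0 works.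
-- Comparisons are made request by request on the surplus α·rhs + β·err₀ + γ·err₁ − lhs,
-- which is additive over requests.
module Submission where

open import Defs
open import Data.Nat using (ℕ; _≤_)
open import Data.Rational using (ℚ)
open import Data.Product using (Σ; _×_)
open import Data.Unit using (⊤)
open import Data.List using (List)

open import Data.Bool using (Bool; true; false; not; _∧_; _∨_; if_then_else_)
open import Data.Bool.Properties using (∨-identityʳ; T-≡)
import Data.Integer as ℤ
import Data.Integer.Properties as ℤ
open import Data.List using ([]; _∷_; _++_; [_]; length; map; replicate; applyUpTo; upTo; take)
open import Data.List.Membership.Propositional using (_∈_)
open import Data.List.Properties
  using (map-++; map-∘; length-++; length-++-≤ˡ; length-map; length-replicate; ++-assoc; map-upTo)
open import Data.List.Relation.Unary.All as All using (All; []; _∷_)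
open import Data.List.Relation.Unary.All.Properties using (++⁺; map⁺; replicate⁺; applyUpTo⁺₁)
open import Data.List.Relation.Unary.Any using (here; there)
open import Data.Nat as ℕ using (zero; suc; _+_; _*_; _∸_; _<_; _≡ᵇ_; z≤n; s≤s)
import Data.Nat.Coprimality as Coprime
open import Data.Nat.ListAction using (sum)
open import Data.Nat.ListAction.Properties using (sum-++)
import Data.Nat.Properties as ℕ
open import Algebra.Properties.CommutativeSemigroup ℕ.+-commutativeSemigroup
  using () renaming (interchange to +-interchange)
open import Data.Product as Product using (∃; _,_; proj₁; proj₂)
import Data.Rational as ℚ
import Data.Rational.Properties as ℚ
open import Data.Sum as Sum using (inj₁; inj₂)
open import Function using (_∘_)
open import Function.Bundles using (Equivalence)
open import Level using (0ℓ)
open import Relation.Binary.PropositionalEquality hiding ([_])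
open import Relation.Nullary using (¬_; Dec; yes; no)
open import Relation.Nullary.Decidable using (dec⇒maybe)
open import Tactic.RingSolver using (solve-∀)
open import Tactic.RingSolver.Core.AlmostCommutativeRing using (AlmostCommutativeRing; fromCommutativeRing)

ℚ-ring : AlmostCommutativeRing 0ℓ 0ℓ
ℚ-ring = fromCommutativeRing ℚ.+-*-commutativeRing (λ q → dec⇒maybe (ℚ.0ℚ ℚ.≟ q))

⟦⟧≡mkℚ : ∀ n → ⟦ n ⟧ ≡ ℚ.mkℚ (ℤ.+ n) 0 (Coprime.sym (Coprime.1-coprimeTo n))
⟦⟧≡mkℚ n = ℚ.normalize-coprime _

⟦⟧-+ : ∀ m n → ⟦ m + n ⟧ ≡ ⟦ m ⟧ ℚ.+ ⟦ n ⟧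
⟦⟧-+ m n rewrite ⟦⟧≡mkℚ m | ⟦⟧≡mkℚ n =
  ℚ./-cong (trans (ℤ.pos-+ m n) (sym (cong₂ ℤ._+_ (ℤ.*-identityʳ (ℤ.+ m)) (ℤ.*-identityʳ (ℤ.+ n))))) refl

⟦⟧-nonNeg : ∀ n → ℚ.0ℚ ℚ.≤ ⟦ n ⟧
⟦⟧-nonNeg n = ℚ.nonNegative⁻¹ _ {{ℚ.normalize-nonNeg n 1}}

p≤p+q : ∀ p {q} → ℚ.0ℚ ℚ.≤ q → p ℚ.≤ p ℚ.+ q
p≤p+q p 0≤q = subst (ℚ._≤ p ℚ.+ _) (ℚ.+-identityʳ p) (ℚ.+-monoʳ-≤ p 0≤q)

p≤q⇒0≤q-p : ∀ {p q} → p ℚ.≤ q → ℚ.0ℚ ℚ.≤ q ℚ.- p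
p≤q⇒0≤q-p {p} {q} p≤q = subst (ℚ._≤ q ℚ.- p) (ℚ.+-inverseʳ p) (ℚ.+-monoˡ-≤ (ℚ.- p) p≤q)

p≤q⇒p-q≤0 : ∀ {p q} → p ℚ.≤ q → p ℚ.- q ℚ.≤ ℚ.0ℚ
p≤q⇒p-q≤0 {p} {q} p≤q = subst (p ℚ.- q ℚ.≤_) (ℚ.+-inverseʳ q) (ℚ.+-monoˡ-≤ (ℚ.- q) p≤q)

p<q⇒0<q-p : ∀ {p q} → p ℚ.< q → ℚ.0ℚ ℚ.< q ℚ.- p
p<q⇒0<q-p {p} {q} p<q = subst (ℚ._< q ℚ.- p) (ℚ.+-inverseʳ p) (ℚ.+-monoˡ-< (ℚ.- p) p<q)

x≤y+b⇒-b≤y-x : ∀ {x y b} → x ℚ.≤ y ℚ.+ b → ℚ.- b ℚ.≤ y ℚ.- x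
x≤y+b⇒-b≤y-x {x} {y} {b} x≤y+b =
  subst₂ ℚ._≤_ (cancelˡ x b) (cancelʳ x y b) (ℚ.+-monoˡ-≤ (ℚ.- x ℚ.- b) x≤y+b)
  where
  cancelˡ : ∀ x b → x ℚ.+ (ℚ.- x ℚ.- b) ≡ ℚ.- b
  cancelˡ = solve-∀ ℚ-ring
  cancelʳ : ∀ x y b → y ℚ.+ b ℚ.+ (ℚ.- x ℚ.- b) ≡ y ℚ.- x
  cancelʳ = solve-∀ ℚ-ring

-b≤y-x⇒x≤y+b : ∀ {x y b} → ℚ.- b ℚ.≤ y ℚ.- x → x ℚ.≤ y ℚ.+ b
-b≤y-x⇒x≤y+b {x} {y} {b} -b≤y-x =
  subst₂ ℚ._≤_ (cancelˡ x b) (cancelʳ x y b) (ℚ.+-monoˡ-≤ (x ℚ.+ b) -b≤y-x)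
  where
  cancelˡ : ∀ x b → ℚ.- b ℚ.+ (x ℚ.+ b) ≡ x
  cancelˡ = solve-∀ ℚ-ring
  cancelʳ : ∀ x y b → y ℚ.- x ℚ.+ (x ℚ.+ b) ≡ y ℚ.+ b
  cancelʳ = solve-∀ ℚ-ring

⟦⟧-mono-≤ : ∀ {m n} → m ≤ n → ⟦ m ⟧ ℚ.≤ ⟦ n ⟧
⟦⟧-mono-≤ {m} {n} m≤n = subst (⟦ m ⟧ ℚ.≤_) (trans (sym (⟦⟧-+ m (n ∸ m))) (cong ⟦_⟧ (ℕ.m+[n∸m]≡n m≤n)))
  (p≤p+q ⟦ m ⟧ (⟦⟧-nonNeg (n ∸ m)))

⟦⟧-unbounded : ∀ q → ∃ λ n → q ℚ.< ⟦ n ⟧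
⟦⟧-unbounded q@(ℚ.mkℚ num d _) =
  suc ℤ.∣ num ∣ , subst (q ℚ.<_) (sym (⟦⟧≡mkℚ (suc ℤ.∣ num ∣))) (ℚ.*<* num<)
  where
  i≤∣i∣ : ∀ i → i ℤ.≤ ℤ.+ ℤ.∣ i ∣
  i≤∣i∣ (ℤ.+ n)    = ℤ.≤-refl
  i≤∣i∣ ℤ.-[1+ n ] = ℤ.-≤+
  open ℤ.≤-Reasoning
  num< : num ℤ.* ℤ.+ 1 ℤ.< ℤ.+ suc ℤ.∣ num ∣ ℤ.* ℤ.+ suc d
  num< = begin-strict
    num ℤ.* ℤ.+ 1                   ≡⟨ ℤ.*-identityʳ num ⟩
    num                             ≤⟨ i≤∣i∣ num ⟩
    ℤ.+ ℤ.∣ num ∣                   <⟨ ℤ.+<+ (ℕ.n<1+n _) ⟩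
    ℤ.+ suc ℤ.∣ num ∣               ≤⟨ ℤ.+≤+ (ℕ.m≤m*n (suc ℤ.∣ num ∣) (suc d)) ⟩
    ℤ.+ (suc ℤ.∣ num ∣ * suc d)     ≡⟨ ℤ.pos-* (suc ℤ.∣ num ∣) (suc d) ⟩
    ℤ.+ suc ℤ.∣ num ∣ ℤ.* ℤ.+ suc d ∎

archimedean : ∀ b ε → ℚ.0ℚ ℚ.< ε → ∃ λ n → b ℚ.< ⟦ n ⟧ ℚ.* ε
archimedean b ε 0<ε =
  n , subst (ℚ._< ⟦ n ⟧ ℚ.* ε) b/ε*ε≡b (ℚ.*-monoˡ-<-pos ε {{ℚ.positive 0<ε}} b/ε<n)
  where
  instance
    ε≢0 : ℚ.NonZero ε
    ε≢0 = ℚ.>-nonZero 0<ε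
  n : ℕ
  n = proj₁ (⟦⟧-unbounded (b ℚ.* ℚ.1/ ε))
  b/ε<n : b ℚ.* ℚ.1/ ε ℚ.< ⟦ n ⟧
  b/ε<n = proj₂ (⟦⟧-unbounded (b ℚ.* ℚ.1/ ε))
  b/ε*ε≡b : b ℚ.* ℚ.1/ ε ℚ.* ε ≡ b
  b/ε*ε≡b = trans (ℚ.*-assoc b _ ε) (trans (cong (b ℚ.*_) (ℚ.*-inverseˡ ε)) (ℚ.*-identityʳ b))

nth-++ˡ : ∀ {A : Set} (d : A) xs ys {i} → i < length xs → nth d (xs ++ ys) i ≡ nth d xs i
nth-++ˡ d (x ∷ xs) ys {zero}  _         = refl
nth-++ˡ d (x ∷ xs) ys {suc i} (s≤s i<n) = nth-++ˡ d xs ys i<n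

nth-replicate-++ˡ : ∀ {A : Set} (d a : A) m ys {i} → i < m → nth d (replicate m a ++ ys) i ≡ a
nth-replicate-++ˡ d a (suc m) ys {zero}  _         = refl
nth-replicate-++ˡ d a (suc m) ys {suc i} (s≤s i<m) = nth-replicate-++ˡ d a m ys i<m

nth-replicate-++ʳ : ∀ {A : Set} (d a : A) m ys i → nth d (replicate m a ++ ys) (m + i) ≡ nth d ys i
nth-replicate-++ʳ d a zero    ys i = refl
nth-replicate-++ʳ d a (suc m) ys i = nth-replicate-++ʳ d a m ys i

nth-map-[_] : ∀ cs {i} → i < length cs → nth [] (map [_] cs) i ≡ [ nth 0 cs i ]
nth-map-[_] (c ∷ cs) {zero}  _         = refl
nth-map-[_] (c ∷ cs) {suc i} (s≤s i<n) = nth-map-[_] cs i<n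

nth-All : ∀ {A : Set} {P : A → Set} {d xs i} → All P xs → i < length xs → P (nth d xs i)
nth-All {i = zero}  (Px ∷ Pxs) _         = Px
nth-All {i = suc i} (Px ∷ Pxs) (s≤s i<n) = nth-All Pxs i<n

nth-≥-length : ∀ {A : Set} (d : A) xs {i} → length xs ≤ i → nth d xs i ≡ d
nth-≥-length d []       _         = refl
nth-≥-length d (x ∷ xs) (s≤s n≤i) = nth-≥-length d xs n≤i

map-const : ∀ {A B : Set} (b : B) (xs : List A) → map (λ _ → b) xs ≡ replicate (length xs) b
map-const b []       = refl
map-const b (x ∷ xs) = cong (b ∷_) (map-const b xs)

sum-map-++ : ∀ {A : Set} (f : A → ℕ) xs ys → sum (map f (xs ++ ys)) ≡ sum (map f xs) + sum (map f ys)
sum-map-++ f xs ys = trans (cong sum (map-++ f xs ys)) (sum-++ (map f xs) (map f ys))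

sum-map-replicate : ∀ {A : Set} (f : A → ℕ) n a → sum (map f (replicate n a)) ≡ n * f a
sum-map-replicate f zero    a = refl
sum-map-replicate f (suc n) a = cong (f a +_) (sum-map-replicate f n a)

sum-applyUpTo-nth : ∀ {A : Set} (f : A → ℕ) d xs →
  sum (applyUpTo (f ∘ nth d xs) (length xs)) ≡ sum (map f xs)
sum-applyUpTo-nth f d []       = refl
sum-applyUpTo-nth f d (x ∷ xs) = cong (f x +_) (sum-applyUpTo-nth f d xs)

sum-applyUpTo-0 : ∀ n → sum (applyUpTo (λ _ → 0) n) ≡ 0
sum-applyUpTo-0 zero    = refl
sum-applyUpTo-0 (suc n) = sum-applyUpTo-0 n

applyUpTo-+ : ∀ {A : Set} (f : ℕ → A) m n → applyUpTo f (m + n) ≡ applyUpTo f m ++ applyUpTo (f ∘ (m +_)) n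
applyUpTo-+ f zero    n = refl
applyUpTo-+ f (suc m) n = cong (f 0 ∷_) (applyUpTo-+ (f ∘ suc) m n)

sum-applyUpTo-mono : ∀ {f g : ℕ → ℕ} n → (∀ {i} → i < n → f i ≤ g i) →
  sum (applyUpTo f n) ≤ sum (applyUpTo g n)
sum-applyUpTo-mono zero    f≤g = z≤n
sum-applyUpTo-mono (suc n) f≤g = ℕ.+-mono-≤ (f≤g (s≤s z≤n)) (sum-applyUpTo-mono n (f≤g ∘ s≤s))

countᵇ-upTo : ∀ p n → countᵇ p (upTo n) ≡ sum (applyUpTo (bit ∘ p) n)
countᵇ-upTo p n = cong sum (map-upTo (bit ∘ p) n)

countᵇ-false : ∀ l → countᵇ (λ _ → false) l ≡ 0
countᵇ-false []      = refl
countᵇ-false (_ ∷ l) = countᵇ-false l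

countᵇ-∨ : ∀ p q l → countᵇ (λ j → p j ∨ q j) l ≤ countᵇ p l + countᵇ q l
countᵇ-∨ p q []      = z≤n
countᵇ-∨ p q (j ∷ l) = ℕ.≤-trans (ℕ.+-mono-≤ (bit-∨ (p j) (q j)) (countᵇ-∨ p q l))
  (ℕ.≤-reflexive (+-interchange (bit (p j)) (bit (q j)) (countᵇ p l) (countᵇ q l)))
  where
  bit-∨ : ∀ a b → bit (a ∨ b) ≤ bit a + bit b
  bit-∨ true  b = s≤s z≤n
  bit-∨ false b = ℕ.≤-refl

countᵇ-≡ᵇ-upTo : ∀ c n → countᵇ (c ≡ᵇ_) (upTo n) ≤ 1
countᵇ-≡ᵇ-upTo c n rewrite countᵇ-upTo (c ≡ᵇ_) n = atMostOnce c n
  where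
  atMostOnce : ∀ c n → sum (applyUpTo (λ j → bit (c ≡ᵇ j)) n) ≤ 1
  atMostOnce c       zero    = z≤n
  atMostOnce zero    (suc n) = s≤s (ℕ.≤-reflexive (sum-applyUpTo-0 n))
  atMostOnce (suc c) (suc n) = atMostOnce c n

countᵇ-memᵇ-upTo : ∀ r n → countᵇ (λ j → memᵇ j r) (upTo n) ≤ length r
countᵇ-memᵇ-upTo []      n = ℕ.≤-reflexive (countᵇ-false (upTo n))
countᵇ-memᵇ-upTo (c ∷ r) n = ℕ.≤-trans (countᵇ-∨ (c ≡ᵇ_) (λ j → memᵇ j r) (upTo n))
  (ℕ.+-mono-≤ (countᵇ-≡ᵇ-upTo c n) (countᵇ-memᵇ-upTo r n))

degree≤ : ∀ rs i → degree rs i ≤ length (nth [] rs i) + sum (map (λ r → bit (memᵇ i r)) rs)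
degree≤ rs i =
  ℕ.≤-trans (countᵇ-∨ (λ j → memᵇ j (nth [] rs i)) (λ j → memᵇ i (nth [] rs j)) (upTo (length rs)))
    (ℕ.+-mono-≤ (countᵇ-memᵇ-upTo (nth [] rs i) (length rs))
      (ℕ.≤-reflexive (trans (countᵇ-upTo _ (length rs)) (sum-applyUpTo-nth (λ r → bit (memᵇ i r)) [] rs))))

≡ᵇ-refl : ∀ n → (n ≡ᵇ n) ≡ true
≡ᵇ-refl zero    = refl
≡ᵇ-refl (suc n) = ≡ᵇ-refl n

≡ᵇ-true⇒≡ : ∀ {m n} → (m ≡ᵇ n) ≡ true → m ≡ n
≡ᵇ-true⇒≡ {m} {n} e = ℕ.≡ᵇ⇒≡ m n (Equivalence.from T-≡ e)

memᵇ-[_] : ∀ c j → memᵇ j [ c ] ≡ (c ≡ᵇ j)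
memᵇ-[_] c j = ∨-identityʳ (c ≡ᵇ j)

nth-runFrom : ∀ {R : Set} (A : OnlineAlg R) h qs d {i} → i < length qs →
  nth d (runFrom A h qs) i ≡ A (h ++ take (suc i) qs)
nth-runFrom A h (q ∷ qs) d {zero}  _         = refl
nth-runFrom A h (q ∷ qs) d {suc i} (s≤s i<n) =
  trans (nth-runFrom A (h ++ [ q ]) qs d i<n) (cong A (++-assoc h [ q ] (take (suc i) qs)))

length-runFrom : ∀ {R : Set} (A : OnlineAlg R) h qs → length (runFrom A h qs) ≡ length qs
length-runFrom A h []       = refl
length-runFrom A h (q ∷ qs) = cong suc (length-runFrom A (h ++ [ q ]) qs)

length-run : ∀ {R : Set} (A : OnlineAlg R) I → length (run A I) ≡ length I
length-run A I = trans (length-runFrom A [] (inputs I)) (length-map _ I)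

runFrom-const : ∀ {R : Set} y h (qs : List (R × Bool)) → runFrom (λ _ → y) h qs ≡ map (λ _ → y) qs
runFrom-const y h []       = refl
runFrom-const y h (q ∷ qs) = cong (y ∷_) (runFrom-const y (h ++ [ q ]) qs)

-- Both competitiveness inequalities read ⟦ lhs ⟧ ≤ α ⟦ rhs ⟧ + β ⟦ err₀ ⟧ + γ ⟦ err₁ ⟧ + b,
-- with (lhs , rhs) = (Alg , Opt) for ASG and (Opt , Alg) for BDIS.
record Tally : Set where
  constructor tally
  field
    lhs rhs err₀ err₁ : ℕ

open Tally

∅ : Tally
∅ = tally 0 0 0 0

infixr 6 _⊕_

_⊕_ : Tally → Tally → Tally
u ⊕ v = tally (lhs u + lhs v) (rhs u + rhs v) (err₀ u + err₀ v) (err₁ u + err₁ v)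

hasLeaves : ℕ → Bool
hasLeaves zero    = false
hasLeaves (suc _) = true

starOpt : ℕ → ℕ
starOpt k = bit (not (hasLeaves k)) + k

-- The largest independent set of a star with k leaves whose centre is rejected (y = true)
-- or accepted (y = false).
starProfit : Bool → ℕ → ℕ
starProfit false k = 1
starProfit true  k = k

starProfit≤starOpt : ∀ y k → starProfit y k ≤ starOpt k
starProfit≤starOpt false zero    = ℕ.≤-refl
starProfit≤starOpt false (suc k) = s≤s z≤n
starProfit≤starOpt true  zero    = z≤n
starProfit≤starOpt true  (suc k) = ℕ.≤-refl

starProfit-bits : ∀ y k → starProfit y k ≡ bit (not y) + k * bit y
starProfit-bits false k = sym (cong suc (ℕ.*-zeroʳ k))
starProfit-bits true  k = sym (ℕ.*-identityʳ k)

starTally : Bool → ℕ → Bool → Tally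
starTally p k y = tally (starOpt k) (starProfit y k) (bit (hasLeaves k ∧ not p)) (bit (not (hasLeaves k) ∧ p))

starTally-accepted : ∀ {t} → 1 ≤ t → ∀ p → starTally p t false ≡ tally t 1 (bit (not p)) 0
starTally-accepted (s≤s z≤n) p = refl

forestTally : Bool → List ℕ → (ℕ → Bool) → Tally
forestTally p []       d = ∅
forestTally p (k ∷ ks) d = starTally p k (d 0) ⊕ forestTally p ks (d ∘ suc)

leafCentres : List ℕ → List ℕ
leafCentres []       = []
leafCentres (k ∷ ks) = replicate k 0 ++ map suc (leafCentres ks)

centre : Bool → ℕ → List ℕ × Bool × Bool
centre p k = [] , p , hasLeaves k

leaf : ℕ → List ℕ × Bool × Bool
leaf c = [ c ] , false , false

starForest : Bool → List ℕ → Instance (List ℕ)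
starForest p ks = map (centre p) ks ++ map leaf (leafCentres ks)

starRequests : ℕ → List ℕ → List (List ℕ)
starRequests m cs = replicate m [] ++ map [_] cs

length-starRequests : ∀ m cs → length (starRequests m cs) ≡ m + length cs
length-starRequests m cs =
  trans (length-++ (replicate m [])) (cong₂ _+_ (length-replicate m) (length-map [_] cs))

starRequests-edge : ∀ m cs i j → memᵇ j (nth [] (starRequests m cs) i) ≡ true → m ≤ i × j ∈ cs
starRequests-edge zero    cs i       j e = z≤n , leafEdge cs i e
  where
  leafEdge : ∀ cs i → memᵇ j (nth [] (map [_] cs) i) ≡ true → j ∈ cs
  leafEdge (c ∷ cs) zero    e = here (sym (≡ᵇ-true⇒≡ (trans (sym (memᵇ-[_] c j)) e)))
  leafEdge (c ∷ cs) (suc i) e = there (leafEdge cs i e)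
starRequests-edge (suc m) cs (suc i) j e = Product.map₁ s≤s (starRequests-edge m cs i j e)

starRequests-leafEdge : ∀ m cs {p} → p < length cs → adj (starRequests m cs) (m + p) (nth 0 cs p) ≡ true
starRequests-leafEdge m cs {p} p<n = cong (_∨ memᵇ (m + p) (nth [] (starRequests m cs) c)) leafSeesCentre
  where
  open ≡-Reasoning
  c : ℕ
  c = nth 0 cs p
  leafSeesCentre : memᵇ c (nth [] (starRequests m cs) (m + p)) ≡ true
  leafSeesCentre = begin
    memᵇ c (nth [] (starRequests m cs) (m + p)) ≡⟨ cong (memᵇ c) (nth-replicate-++ʳ [] [] m (map [_] cs) p) ⟩
    memᵇ c (nth [] (map [_] cs) p)              ≡⟨ cong (memᵇ c) (nth-map-[_] cs p<n) ⟩
    memᵇ c [ c ]                                ≡⟨ memᵇ-[_] c c ⟩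
    c ≡ᵇ c                                      ≡⟨ ≡ᵇ-refl c ⟩
    true                                        ∎

starRequests-inDegree : ∀ m cs i → sum (map (λ r → bit (memᵇ i r)) (starRequests m cs)) ≡ countᵇ (_≡ᵇ i) cs
starRequests-inDegree (suc m) cs       i = starRequests-inDegree m cs i
starRequests-inDegree zero    []       i = refl
starRequests-inDegree zero    (c ∷ cs) i = cong₂ _+_ (cong bit (memᵇ-[_] c i)) (starRequests-inDegree zero cs i)

starRequests-requestLength : ∀ m cs {i} → i < length (starRequests m cs) →
  length (nth [] (starRequests m cs) i) ≤ 1
starRequests-requestLength m cs =
  nth-All {P = λ r → length r ≤ 1} (++⁺ (replicate⁺ m z≤n) (map⁺ (All.universal (λ _ → ℕ.≤-refl) cs)))

starRequests-zeros≤ : ∀ m cs z → All (_< m) cs → length z ≡ m + length cs →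
  IndependentZeros (starRequests m cs) z →
  zeros z ≤ sum (applyUpTo (λ i → bit (not (nth true z i))) m) + sum (map (λ c → bit (nth true z c)) cs)
starRequests-zeros≤ m cs z cs<m |z| independent = begin
  zeros z                                                      ≡⟨ sym (sum-applyUpTo-nth (bit ∘ not) true z) ⟩
  sum (applyUpTo inSet (length z))                             ≡⟨ cong (sum ∘ applyUpTo inSet) |z| ⟩
  sum (applyUpTo inSet (m + L))                                ≡⟨ cong sum (applyUpTo-+ inSet m L) ⟩
  sum (applyUpTo inSet m ++ applyUpTo (inSet ∘ (m +_)) L)      ≡⟨ sum-++ (applyUpTo inSet m) _ ⟩
  sum (applyUpTo inSet m) + sum (applyUpTo (inSet ∘ (m +_)) L)
    ≤⟨ ℕ.+-monoʳ-≤ (sum (applyUpTo inSet m)) (sum-applyUpTo-mono L leafIn⇒centreOut) ⟩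
  sum (applyUpTo inSet m) + sum (applyUpTo (outSet ∘ nth 0 cs) L)
    ≡⟨ cong (sum (applyUpTo inSet m) +_) (sum-applyUpTo-nth outSet 0 cs) ⟩
  sum (applyUpTo inSet m) + sum (map outSet cs)                ∎
  where
  open ℕ.≤-Reasoning
  L : ℕ
  L = length cs
  inSet outSet : ℕ → ℕ
  inSet i = bit (not (nth true z i))
  outSet i = bit (nth true z i)
  |rs| : length (starRequests m cs) ≡ m + L
  |rs| = length-starRequests m cs
  leafIn⇒centreOut : ∀ {p} → p < L → inSet (m + p) ≤ outSet (nth 0 cs p)
  leafIn⇒centreOut {p} p<L with nth true z (m + p) in leafOut | nth true z (nth 0 cs p) in centreOut
  ... | true  | _     = z≤n
  ... | false | true  = ℕ.≤-refl
  ... | false | false with () ← trans (sym (starRequests-leafEdge m cs p<L))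
        (independent (m + p) (nth 0 cs p) (subst (m + p <_) (sym |rs|) (ℕ.+-monoʳ-< m p<L))
          (subst (nth 0 cs p <_) (sym |rs|) (ℕ.<-≤-trans (nth-All cs<m p<L) (ℕ.m≤m+n m L)))
          leafOut centreOut)

sum-map-leafCentres-∷ : ∀ (f : ℕ → ℕ) k ks →
  sum (map f (leafCentres (k ∷ ks))) ≡ k * f 0 + sum (map (f ∘ suc) (leafCentres ks))
sum-map-leafCentres-∷ f k ks = trans (sum-map-++ f (replicate k 0) (map suc (leafCentres ks)))
  (cong₂ _+_ (sum-map-replicate f k 0) (cong sum (sym (map-∘ (leafCentres ks)))))

length-leafCentres-∷ : ∀ k ks → length (leafCentres (k ∷ ks)) ≡ k + length (leafCentres ks)
length-leafCentres-∷ k ks = trans (length-++ (replicate k 0))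
  (cong₂ _+_ (length-replicate k) (length-map suc (leafCentres ks)))

multiplicity-leafCentres : ∀ ks i → countᵇ (_≡ᵇ i) (leafCentres ks) ≡ nth 0 ks i
multiplicity-leafCentres []       i       = refl
multiplicity-leafCentres (k ∷ ks) zero    = trans (sum-map-leafCentres-∷ (λ c → bit (c ≡ᵇ 0)) k ks)
  (trans (cong₂ _+_ (ℕ.*-identityʳ k) (countᵇ-false (leafCentres ks))) (ℕ.+-identityʳ k))
multiplicity-leafCentres (k ∷ ks) (suc i) = trans (sum-map-leafCentres-∷ (λ c → bit (c ≡ᵇ suc i)) k ks)
  (trans (cong (_+ countᵇ (_≡ᵇ i) (leafCentres ks)) (ℕ.*-zeroʳ k)) (multiplicity-leafCentres ks i))

leafCentres-centres : ∀ ks →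
  All (λ c → c < length ks × nth true (map hasLeaves ks) c ≡ true) (leafCentres ks)
leafCentres-centres []       = []
leafCentres-centres (k ∷ ks) =
  ++⁺ (ownLeaves k) (map⁺ (All.map (Product.map₁ s≤s) (leafCentres-centres ks)))
  where
  ownLeaves : ∀ k → All (λ c → c < suc (length ks) × nth true (map hasLeaves (k ∷ ks)) c ≡ true) (replicate k 0)
  ownLeaves zero    = []
  ownLeaves (suc k) = replicate⁺ (suc k) (s≤s z≤n , refl)

requests-starForest : ∀ p ks → requests (starForest p ks) ≡ starRequests (length ks) (leafCentres ks)
requests-starForest p ks = trans (map-++ proj₁ (map (centre p) ks) (map leaf (leafCentres ks)))
  (cong₂ _++_ (trans (sym (map-∘ ks)) (map-const [] ks)) (sym (map-∘ (leafCentres ks))))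

truth-starForest : ∀ p ks → truth (starForest p ks) ≡ map hasLeaves ks ++ map (λ _ → false) (leafCentres ks)
truth-starForest p ks = trans (map-++ _ (map (centre p) ks) (map leaf (leafCentres ks)))
  (cong₂ _++_ (sym (map-∘ ks)) (sym (map-∘ (leafCentres ks))))

forestTally-cong : ∀ p ks {d d′ : ℕ → Bool} → (∀ {i} → i < length ks → d i ≡ d′ i) →
  forestTally p ks d ≡ forestTally p ks d′
forestTally-cong p []       d≡d′ = refl
forestTally-cong p (k ∷ ks) d≡d′ =
  cong₂ _⊕_ (cong (starTally p k) (d≡d′ (s≤s z≤n))) (forestTally-cong p ks (d≡d′ ∘ s≤s))

forestTally-rhs≤lhs : ∀ p ks d → rhs (forestTally p ks d) ≤ lhs (forestTally p ks d)
forestTally-rhs≤lhs p []       d = z≤n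
forestTally-rhs≤lhs p (k ∷ ks) d = ℕ.+-mono-≤ (starProfit≤starOpt (d 0) k) (forestTally-rhs≤lhs p ks (d ∘ suc))

forestTally-lhs : ∀ p ks d → lhs (forestTally p ks d) ≡ zeros (map hasLeaves ks) + length (leafCentres ks)
forestTally-lhs p []       d = refl
forestTally-lhs p (k ∷ ks) d = begin
  starOpt k + lhs (forestTally p ks (d ∘ suc))
    ≡⟨ cong (starOpt k +_) (forestTally-lhs p ks (d ∘ suc)) ⟩
  (bit (not (hasLeaves k)) + k) + (zeros (map hasLeaves ks) + length (leafCentres ks))
    ≡⟨ +-interchange (bit (not (hasLeaves k))) k _ _ ⟩
  (bit (not (hasLeaves k)) + zeros (map hasLeaves ks)) + (k + length (leafCentres ks))
    ≡⟨ cong (zeros (map hasLeaves (k ∷ ks)) +_) (sym (length-leafCentres-∷ k ks)) ⟩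
  zeros (map hasLeaves (k ∷ ks)) + length (leafCentres (k ∷ ks)) ∎
  where open ≡-Reasoning

forestTally-rhs : ∀ p ks d →
  sum (applyUpTo (λ i → bit (not (d i))) (length ks)) + sum (map (λ c → bit (d c)) (leafCentres ks)) ≡
  rhs (forestTally p ks d)
forestTally-rhs p []       d = refl
forestTally-rhs p (k ∷ ks) d = begin
  (bit (not (d 0)) + centres) + sum (map (λ c → bit (d c)) (leafCentres (k ∷ ks)))
    ≡⟨ cong ((bit (not (d 0)) + centres) +_) (sum-map-leafCentres-∷ (λ c → bit (d c)) k ks) ⟩
  (bit (not (d 0)) + centres) + (k * bit (d 0) + leaves)
    ≡⟨ +-interchange (bit (not (d 0))) centres (k * bit (d 0)) leaves ⟩
  (bit (not (d 0)) + k * bit (d 0)) + (centres + leaves)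
    ≡⟨ cong₂ _+_ (sym (starProfit-bits (d 0) k)) (forestTally-rhs p ks (d ∘ suc)) ⟩
  starProfit (d 0) k + rhs (forestTally p ks (d ∘ suc)) ∎
  where
  open ≡-Reasoning
  centres leaves : ℕ
  centres = sum (applyUpTo (λ i → bit (not (d (suc i)))) (length ks))
  leaves  = sum (map (λ c → bit (d (suc c))) (leafCentres ks))

forestTally-err₀ : ∀ p ks d → err₀ (forestTally p ks d) ≡ μ₀ (map (centre p) ks)
forestTally-err₀ p []       d = refl
forestTally-err₀ p (k ∷ ks) d = cong (bit (hasLeaves k ∧ not p) +_) (forestTally-err₀ p ks (d ∘ suc))

forestTally-err₁ : ∀ p ks d → err₁ (forestTally p ks d) ≡ μ₁ (map (centre p) ks)
forestTally-err₁ p []       d = refl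
forestTally-err₁ p (k ∷ ks) d = cong (bit (not (hasLeaves k) ∧ p) +_) (forestTally-err₁ p ks (d ∘ suc))

μ₀-leaves : ∀ cs → μ₀ (map leaf cs) ≡ 0
μ₀-leaves []       = refl
μ₀-leaves (c ∷ cs) = μ₀-leaves cs

μ₁-leaves : ∀ cs → μ₁ (map leaf cs) ≡ 0
μ₁-leaves []       = refl
μ₁-leaves (c ∷ cs) = μ₁-leaves cs

zeros-map-false : ∀ {A : Set} (xs : List A) → zeros (map (λ _ → false) xs) ≡ length xs
zeros-map-false []       = refl
zeros-map-false (x ∷ xs) = cong suc (zeros-map-false xs)

module _ (ks : List ℕ) where

  private
    m : ℕ
    m = length ks
    cs : List ℕ
    cs = leafCentres ks
    rs : List (List ℕ)
    rs = starRequests m cs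

  starForest-wellFormed : WellFormed rs
  starForest-wellFormed i j _ e with starRequests-edge m cs i j e
  ... | m≤i , j∈cs = ℕ.<-≤-trans (proj₁ (All.lookup (leafCentres-centres ks) j∈cs)) m≤i

  starForest-maxDegree : ∀ {t} → 1 ≤ t → All (_≤ t) ks → MaxDegreeAtMost t rs
  starForest-maxDegree {t} 1≤t ks≤t i i<n = begin
    degree rs i                                                ≤⟨ degree≤ rs i ⟩
    length (nth [] rs i) + sum (map (λ r → bit (memᵇ i r)) rs) ≡⟨ cong (length (nth [] rs i) +_) inDegree ⟩
    length (nth [] rs i) + nth 0 ks i                          ≤⟨ centreOrLeaf (i ℕ.<? m) ⟩
    t                                                          ∎
    where
    open ℕ.≤-Reasoning
    inDegree : sum (map (λ r → bit (memᵇ i r)) rs) ≡ nth 0 ks i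
    inDegree = trans (starRequests-inDegree m cs i) (multiplicity-leafCentres ks i)
    centreOrLeaf : Dec (i < m) → length (nth [] rs i) + nth 0 ks i ≤ t
    centreOrLeaf (yes i<m) rewrite nth-replicate-++ˡ [] [] m (map [_] cs) i<m = nth-All ks≤t i<m
    centreOrLeaf (no i≮m)  rewrite nth-≥-length 0 ks (ℕ.≮⇒≥ i≮m) | ℕ.+-identityʳ (length (nth [] rs i)) =
      ℕ.≤-trans (starRequests-requestLength m cs i<n) 1≤t

  starForest-centreTruth : ∀ p {c} → c ∈ cs → nth true (truth (starForest p ks)) c ≡ true
  starForest-centreTruth p c∈cs with All.lookup (leafCentres-centres ks) c∈cs
  ... | c<m , isCentre = trans (cong (λ x → nth true x _) (truth-starForest p ks))
    (trans (nth-++ˡ true (map hasLeaves ks) _ (subst (_ <_) (sym (length-map hasLeaves ks)) c<m)) isCentre)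

  starForest-noEdgeInto : ∀ p i j → nth true (truth (starForest p ks)) j ≡ false →
    memᵇ j (nth [] rs i) ≡ false
  starForest-noEdgeInto p i j xⱼ with memᵇ j (nth [] rs i) in e
  ... | false = refl
  ... | true  with () ← trans (sym (starForest-centreTruth p (proj₂ (starRequests-edge m cs i j e)))) xⱼ

  starForest-truthIndependent : ∀ p → IndependentZeros rs (truth (starForest p ks))
  starForest-truthIndependent p i j _ _ xᵢ xⱼ
    rewrite starForest-noEdgeInto p i j xⱼ | starForest-noEdgeInto p j i xᵢ = refl

  starForest-zeros≤ : ∀ p z → length z ≡ length rs → IndependentZeros rs z →
    zeros z ≤ rhs (forestTally p ks (nth true z))
  starForest-zeros≤ p z |z| independent = ℕ.≤-trans
    (starRequests-zeros≤ m cs z (All.map proj₁ (leafCentres-centres ks))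
      (trans |z| (length-starRequests m cs)) independent)
    (ℕ.≤-reflexive (forestTally-rhs p ks (nth true z)))

  zeros-truth-starForest : ∀ p d → zeros (truth (starForest p ks)) ≡ lhs (forestTally p ks d)
  zeros-truth-starForest p d = begin
    zeros (truth (starForest p ks))                         ≡⟨ cong zeros (truth-starForest p ks) ⟩
    zeros (map hasLeaves ks ++ map (λ _ → false) cs)        ≡⟨ sum-map-++ (bit ∘ not) (map hasLeaves ks) _ ⟩
    zeros (map hasLeaves ks) + zeros (map (λ _ → false) cs)
      ≡⟨ cong (zeros (map hasLeaves ks) +_) (zeros-map-false cs) ⟩
    zeros (map hasLeaves ks) + length cs                    ≡⟨ sym (forestTally-lhs p ks d) ⟩
    lhs (forestTally p ks d)                                ∎
    where open ≡-Reasoning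

  μ₀-starForest : ∀ p d → μ₀ (starForest p ks) ≡ err₀ (forestTally p ks d)
  μ₀-starForest p d = trans (sum-map-++ _ (map (centre p) ks) (map leaf cs))
    (trans (cong₂ _+_ (sym (forestTally-err₀ p ks d)) (μ₀-leaves cs)) (ℕ.+-identityʳ _))

  μ₁-starForest : ∀ p d → μ₁ (starForest p ks) ≡ err₁ (forestTally p ks d)
  μ₁-starForest p d = trans (sum-map-++ _ (map (centre p) ks) (map leaf cs))
    (trans (cong₂ _+_ (sym (forestTally-err₁ p ks d)) (μ₁-leaves cs)) (ℕ.+-identityʳ _))

  starForest-valid : ∀ {t} p → 1 ≤ t → All (_≤ t) ks → ValidBDIS t (starForest p ks)
  starForest-valid {t} p 1≤t ks≤t =
    subst (λ rs → WellFormed rs × MaxDegreeAtMost t rs × MaxIndependentZeros rs (truth (starForest p ks)))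
      (sym (requests-starForest p ks))
      (starForest-wellFormed , starForest-maxDegree 1≤t ks≤t , starForest-truthIndependent p , maximum)
    where
    maximum : ∀ z → length z ≡ length rs → IndependentZeros rs z → zeros z ≤ zeros (truth (starForest p ks))
    maximum z |z| independent = ℕ.≤-trans (starForest-zeros≤ p z |z| independent)
      (ℕ.≤-trans (forestTally-rhs≤lhs p ks (nth true z))
        (ℕ.≤-reflexive (sym (zeros-truth-starForest p (nth true z)))))

centreDecision : OnlineAlg (List ℕ) → Bool → ℕ → Bool
centreDecision A p i = A (replicate (suc i) ([] , p))

take-inputs-centres : ∀ p ks (J : Instance (List ℕ)) {i} → i < length ks →
  take (suc i) (inputs (map (centre p) ks ++ J)) ≡ replicate (suc i) ([] , p)
take-inputs-centres p (k ∷ ks) J {zero}  _         = refl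
take-inputs-centres p (k ∷ ks) J {suc i} (s≤s i<m) = cong (([] , p) ∷_) (take-inputs-centres p ks J i<m)

run-starForest : ∀ A p ks {i} → i < length ks → nth true (run A (starForest p ks)) i ≡ centreDecision A p i
run-starForest A p ks {i} i<m =
  trans (nth-runFrom A [] (inputs (starForest p ks)) true i<n) (cong A (take-inputs-centres p ks _ i<m))
  where
  i<n : i < length (inputs (starForest p ks))
  i<n = ℕ.<-≤-trans i<m (ℕ.≤-trans (ℕ.≤-reflexive (sym (length-map (centre p) ks)))
          (ℕ.≤-trans (length-++-≤ˡ (map (centre p) ks)) (ℕ.≤-reflexive (sym (length-map _ (starForest p ks))))))

starSize : ℕ → Bool → Bool → ℕ
starSize t x y = if y then bit x else t

starSize≤ : ∀ {t} → 1 ≤ t → ∀ x y → starSize t x y ≤ t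
starSize≤ 1≤t true  true  = 1≤t
starSize≤ 1≤t false true  = z≤n
starSize≤ 1≤t x     false = ℕ.≤-refl

probeSizes : ℕ → (ℕ → Bool) → ℕ → List ℕ
probeSizes t d N = applyUpTo (starSize t false ∘ d) N

starSizesFor : ℕ → (ℕ → Bool) → Instance ⊤ → List ℕ
starSizesFor t d []                    = []
starSizesFor t d ((_ , false , _) ∷ I) = starSizesFor t d I
starSizesFor t d ((_ , true  , x) ∷ I) = starSize t x (d 0) ∷ starSizesFor t (d ∘ suc) I

starSizesFor-≤ : ∀ {t} → 1 ≤ t → ∀ d I → All (_≤ t) (starSizesFor t d I)
starSizesFor-≤ 1≤t d []                    = []
starSizesFor-≤ 1≤t d ((_ , false , _) ∷ I) = starSizesFor-≤ 1≤t d I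
starSizesFor-≤ 1≤t d ((_ , true  , x) ∷ I) = starSize≤ 1≤t x (d 0) ∷ starSizesFor-≤ 1≤t (d ∘ suc) I

guessCost : ℕ → Bool → Bool → ℕ
guessCost t x     true  = 1
guessCost t true  false = t
guessCost t false false = 0

requestTally : ℕ → Bool → Bool → Bool → Tally
requestTally t p x y = tally (guessCost t x y) (bit x) (bit (x ∧ not p)) (bit (not x ∧ p))

asgTally : ℕ → Instance ⊤ → List Bool → Tally
asgTally t I ys = tally (ASGcost t (truth I) ys) (ones (truth I)) (μ₀ I) (μ₁ I)

asgTally-∷ : ∀ t u p x I y ys →
  asgTally t ((u , p , x) ∷ I) (y ∷ ys) ≡ requestTally t p x y ⊕ asgTally t I ys
asgTally-∷ t u p x I y ys = cong (λ c → tally (c + ASGcost t (truth I) ys) (rhs v) (err₀ v) (err₁ v)) (cost x y)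
  where
  v : Tally
  v = requestTally t p x y ⊕ asgTally t I ys
  cost : ∀ x y → bit y + t * bit (x ∧ not y) ≡ guessCost t x y
  cost true  true  = cong suc (ℕ.*-zeroʳ t)
  cost false true  = cong suc (ℕ.*-zeroʳ t)
  cost true  false = ℕ.*-identityʳ t
  cost false false = ℕ.*-zeroʳ t

currentPrediction : List (⊤ × Bool) → Bool
currentPrediction []          = false
currentPrediction (x ∷ [])    = proj₂ x
currentPrediction (_ ∷ y ∷ h) = currentPrediction (y ∷ h)

currentPrediction-∷ʳ : ∀ h x → currentPrediction (h ++ [ x ]) ≡ proj₂ x
currentPrediction-∷ʳ []          x = refl
currentPrediction-∷ʳ (_ ∷ [])    x = refl
currentPrediction-∷ʳ (_ ∷ y ∷ h) x = currentPrediction-∷ʳ (y ∷ h) x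

trueCount : List (⊤ × Bool) → ℕ
trueCount h = ones (map proj₂ h)

trueCount-∷ʳ : ∀ h x → trueCount (h ++ [ x ]) ≡ trueCount h + bit (proj₂ x)
trueCount-∷ʳ h x = trans (cong ones (map-++ proj₂ h [ x ]))
  (trans (sum-map-++ bit (map proj₂ h) [ proj₂ x ]) (cong (trueCount h +_) (ℕ.+-identityʳ (bit (proj₂ x)))))

trueCount-∷ʳ-+ : ∀ h x i → trueCount (h ++ [ x ]) + i ≡ trueCount h + (bit (proj₂ x) + i)
trueCount-∷ʳ-+ h x i = trans (cong (_+ i) (trueCount-∷ʳ h x)) (ℕ.+-assoc (trueCount h) (bit (proj₂ x)) i)

simulate : OnlineAlg (List ℕ) → OnlineAlg ⊤
simulate A h = if currentPrediction h then A (replicate (trueCount h) ([] , true)) else false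

guesses : (ℕ → Bool) → Instance ⊤ → List Bool
guesses d []                    = []
guesses d ((_ , false , _) ∷ I) = false ∷ guesses d I
guesses d ((_ , true  , _) ∷ I) = d 0 ∷ guesses (d ∘ suc) I

guesses-cong : ∀ {d d′ : ℕ → Bool} I → (∀ i → d i ≡ d′ i) → guesses d I ≡ guesses d′ I
guesses-cong []                    d≡d′ = refl
guesses-cong ((_ , false , _) ∷ I) d≡d′ = cong (false ∷_) (guesses-cong I d≡d′)
guesses-cong ((_ , true  , _) ∷ I) d≡d′ = cong₂ _∷_ (d≡d′ 0) (guesses-cong I (d≡d′ ∘ suc))

runFrom-simulate : ∀ A h I →
  runFrom (simulate A) h (inputs I) ≡ guesses (λ i → centreDecision A true (trueCount h + i)) I
runFrom-simulate A h [] = refl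
runFrom-simulate A h ((u , false , _) ∷ I) rewrite currentPrediction-∷ʳ h (u , false) =
  cong (false ∷_) (trans (runFrom-simulate A (h ++ [ (u , false) ]) I)
    (guesses-cong I (cong (centreDecision A true) ∘ trueCount-∷ʳ-+ h (u , false))))
runFrom-simulate A h ((u , true , _) ∷ I) rewrite currentPrediction-∷ʳ h (u , true) =
  cong₂ _∷_
    (cong (λ n → A (replicate n ([] , true))) (trans (trueCount-∷ʳ h (u , true)) (ℕ.+-suc (trueCount h) 0)))
    (trans (runFrom-simulate A (h ++ [ (u , true) ]) I)
      (guesses-cong I (cong (centreDecision A true) ∘ trueCount-∷ʳ-+ h (u , true))))

run-simulate : ∀ A I → run (simulate A) I ≡ guesses (centreDecision A true) I
run-simulate A I = runFrom-simulate A [] I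

module Surplus (α β γ : ℚ) where

  budget : Tally → ℚ
  budget v = α ℚ.* ⟦ rhs v ⟧ ℚ.+ β ℚ.* ⟦ err₀ v ⟧ ℚ.+ γ ℚ.* ⟦ err₁ v ⟧

  surplus : Tally → ℚ
  surplus v = budget v ℚ.- ⟦ lhs v ⟧

  record Bounded (b : ℚ) (v : Tally) : Set where
    constructor mkBounded
    field
      bound : ⟦ lhs v ⟧ ℚ.≤ budget v ℚ.+ b

  open Bounded public

  infix 4 _≼_

  data _≼_ (u v : Tally) : Set where
    mk≼ : surplus u ℚ.≤ surplus v → u ≼ v

  ≼-refl : ∀ {u} → u ≼ u
  ≼-refl = mk≼ ℚ.≤-refl

  ≼-reflexive : ∀ {u v} → u ≡ v → u ≼ v
  ≼-reflexive refl = ≼-refl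

  bounded⇒-b≤surplus : ∀ {b v} → Bounded b v → ℚ.- b ℚ.≤ surplus v
  bounded⇒-b≤surplus {v = v} (mkBounded lhs≤) = x≤y+b⇒-b≤y-x {⟦ lhs v ⟧} {budget v} lhs≤

  -b≤surplus⇒bounded : ∀ {b v} → ℚ.- b ℚ.≤ surplus v → Bounded b v
  -b≤surplus⇒bounded {v = v} -b≤ = mkBounded (-b≤y-x⇒x≤y+b {⟦ lhs v ⟧} {budget v} -b≤)

  bounded-≼ : ∀ {b u v} → Bounded b u → u ≼ v → Bounded b v
  bounded-≼ bu (mk≼ u≤v) = -b≤surplus⇒bounded (ℚ.≤-trans (bounded⇒-b≤surplus bu) u≤v)

  bounded-mono : NonNeg3 α β γ → ∀ {b u v} → Bounded b u →
    lhs v ≤ lhs u → rhs u ≤ rhs v → err₀ u ≤ err₀ v → err₁ u ≤ err₁ v → Bounded b v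
  bounded-mono (0≤α , 0≤β , 0≤γ) {b} (mkBounded bu) lhs≤ rhs≤ err₀≤ err₁≤ = mkBounded (ℚ.≤-trans (⟦⟧-mono-≤ lhs≤)
    (ℚ.≤-trans bu (ℚ.+-monoˡ-≤ b (ℚ.+-mono-≤ (ℚ.+-mono-≤ (scale 0≤α rhs≤) (scale 0≤β err₀≤)) (scale 0≤γ err₁≤)))))
    where
    scale : ∀ {c m n} → ℚ.0ℚ ℚ.≤ c → m ≤ n → c ℚ.* ⟦ m ⟧ ℚ.≤ c ℚ.* ⟦ n ⟧
    scale {c} 0≤c m≤n = ℚ.*-monoˡ-≤-nonNeg c {{ℚ.nonNegative 0≤c}} (⟦⟧-mono-≤ m≤n)

  surplus-∅ : surplus ∅ ≡ ℚ.0ℚ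
  surplus-∅ = vanish α β γ
    where
    vanish : ∀ α β γ → α ℚ.* ℚ.0ℚ ℚ.+ β ℚ.* ℚ.0ℚ ℚ.+ γ ℚ.* ℚ.0ℚ ℚ.- ℚ.0ℚ ≡ ℚ.0ℚ
    vanish = solve-∀ ℚ-ring

  surplus-⊕ : ∀ u v → surplus (u ⊕ v) ≡ surplus u ℚ.+ surplus v
  surplus-⊕ u v = trans
    (weigh-cong (⟦⟧-+ (lhs u) (lhs v)) (⟦⟧-+ (rhs u) (rhs v)) (⟦⟧-+ (err₀ u) (err₀ v)) (⟦⟧-+ (err₁ u) (err₁ v)))
    (split α β γ ⟦ lhs u ⟧ ⟦ lhs v ⟧ ⟦ rhs u ⟧ ⟦ rhs v ⟧ ⟦ err₀ u ⟧ ⟦ err₀ v ⟧ ⟦ err₁ u ⟧ ⟦ err₁ v ⟧)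
    where
    weigh-cong : ∀ {a a′ o o′ e e′ f f′} → a ≡ a′ → o ≡ o′ → e ≡ e′ → f ≡ f′ →
      α ℚ.* o ℚ.+ β ℚ.* e ℚ.+ γ ℚ.* f ℚ.- a ≡ α ℚ.* o′ ℚ.+ β ℚ.* e′ ℚ.+ γ ℚ.* f′ ℚ.- a′
    weigh-cong refl refl refl refl = refl
    split : ∀ α β γ a a′ o o′ e e′ f f′ →
      α ℚ.* (o ℚ.+ o′) ℚ.+ β ℚ.* (e ℚ.+ e′) ℚ.+ γ ℚ.* (f ℚ.+ f′) ℚ.- (a ℚ.+ a′) ≡
      (α ℚ.* o ℚ.+ β ℚ.* e ℚ.+ γ ℚ.* f ℚ.- a) ℚ.+ (α ℚ.* o′ ℚ.+ β ℚ.* e′ ℚ.+ γ ℚ.* f′ ℚ.- a′)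
    split = solve-∀ ℚ-ring

  ⊕-mono-≼ : ∀ {u u′ v v′} → u ≼ u′ → v ≼ v′ → u ⊕ v ≼ u′ ⊕ v′
  ⊕-mono-≼ {u} {u′} {v} {v′} (mk≼ u≤u′) (mk≼ v≤v′) =
    mk≼ (subst₂ ℚ._≤_ (sym (surplus-⊕ u v)) (sym (surplus-⊕ u′ v′)) (ℚ.+-mono-≤ u≤u′ v≤v′))

  bounded-∅ : Bounded ℚ.0ℚ ∅
  bounded-∅ = -b≤surplus⇒bounded (ℚ.≤-reflexive (sym surplus-∅))

  0≤surplus⇒∅≼ : ∀ {v} → ℚ.0ℚ ℚ.≤ surplus v → ∅ ≼ v
  0≤surplus⇒∅≼ {v} 0≤v = mk≼ (subst (ℚ._≤ surplus v) (sym surplus-∅) 0≤v)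

  surplus-unit-rhs-err₀ : ∀ c → surplus (tally c 1 1 0) ≡ α ℚ.+ β ℚ.- ⟦ c ⟧
  surplus-unit-rhs-err₀ c = eval α β γ ⟦ c ⟧
    where
    eval : ∀ α β γ c → α ℚ.* ℚ.1ℚ ℚ.+ β ℚ.* ℚ.1ℚ ℚ.+ γ ℚ.* ℚ.0ℚ ℚ.- c ≡ α ℚ.+ β ℚ.- c
    eval = solve-∀ ℚ-ring

  surplus-unit-rhs : ∀ c → surplus (tally c 1 0 0) ≡ α ℚ.- ⟦ c ⟧
  surplus-unit-rhs c = eval α β γ ⟦ c ⟧
    where
    eval : ∀ α β γ c → α ℚ.* ℚ.1ℚ ℚ.+ β ℚ.* ℚ.0ℚ ℚ.+ γ ℚ.* ℚ.0ℚ ℚ.- c ≡ α ℚ.- c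
    eval = solve-∀ ℚ-ring

  surplus-unit-err₁ : surplus (tally 0 0 0 1) ≡ γ
  surplus-unit-err₁ = eval α β γ
    where
    eval : ∀ α β γ → α ℚ.* ℚ.0ℚ ℚ.+ β ℚ.* ℚ.0ℚ ℚ.+ γ ℚ.* ℚ.1ℚ ℚ.- ℚ.0ℚ ≡ γ
    eval = solve-∀ ℚ-ring

  surplus-unit-lhs : surplus (tally 1 0 0 0) ≡ ℚ.- ℚ.1ℚ
  surplus-unit-lhs = eval α β γ
    where
    eval : ∀ α β γ → α ℚ.* ℚ.0ℚ ℚ.+ β ℚ.* ℚ.0ℚ ℚ.+ γ ℚ.* ℚ.0ℚ ℚ.- ℚ.1ℚ ≡ ℚ.- ℚ.1ℚ
    eval = solve-∀ ℚ-ring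

  ∅≼guess0-unpredicted : ∀ t → ⟦ t ⟧ ℚ.≤ α ℚ.+ β → ∀ x → ∅ ≼ requestTally t false x false
  ∅≼guess0-unpredicted t t≤α+β true =
    0≤surplus⇒∅≼ (subst (ℚ.0ℚ ℚ.≤_) (sym (surplus-unit-rhs-err₀ t)) (p≤q⇒0≤q-p t≤α+β))
  ∅≼guess0-unpredicted t t≤α+β false = ≼-refl

  ∅≼guess0-predicted : ∀ t → ⟦ t ⟧ ℚ.≤ α → ℚ.0ℚ ℚ.≤ γ → ∀ x → ∅ ≼ requestTally t true x false
  ∅≼guess0-predicted t t≤α 0≤γ true  =
    0≤surplus⇒∅≼ (subst (ℚ.0ℚ ℚ.≤_) (sym (surplus-unit-rhs t)) (p≤q⇒0≤q-p t≤α))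
  ∅≼guess0-predicted t t≤α 0≤γ false = 0≤surplus⇒∅≼ (subst (ℚ.0ℚ ℚ.≤_) (sym surplus-unit-err₁) 0≤γ)

  star≼request : ∀ {t} → 1 ≤ t → α ℚ.≤ ⟦ t ⟧ → ℚ.0ℚ ℚ.≤ γ →
    ∀ x y → starTally true (starSize t x y) y ≼ requestTally t true x y
  star≼request     1≤t α≤t 0≤γ true  true  = ≼-refl
  star≼request     1≤t α≤t 0≤γ false true  = ≼-refl
  star≼request     1≤t α≤t 0≤γ true  false = ≼-reflexive (starTally-accepted 1≤t true)
  star≼request {t} 1≤t α≤t 0≤γ false false = subst (_≼ tally 0 0 0 1) (sym (starTally-accepted 1≤t true))
    (mk≼ (subst₂ ℚ._≤_ (sym (surplus-unit-rhs t)) (sym surplus-unit-err₁) (ℚ.≤-trans (p≤q⇒p-q≤0 α≤t) 0≤γ)))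

  module _ {t} (1≤t : 1 ≤ t) {ε} (ε≤1 : ε ℚ.≤ ℚ.1ℚ) (ε≤t-α-β : ε ℚ.≤ ⟦ t ⟧ ℚ.- (α ℚ.+ β)) where

    probeStar-surplus : ∀ y → surplus (starTally false (starSize t false y) y) ℚ.≤ ℚ.- ε
    probeStar-surplus true  = subst (ℚ._≤ ℚ.- ε) (sym surplus-unit-lhs) (ℚ.neg-antimono-≤ ε≤1)
    probeStar-surplus false = subst (λ v → surplus v ℚ.≤ ℚ.- ε) (sym (starTally-accepted 1≤t false))
      (subst (ℚ._≤ ℚ.- ε) (sym (trans (surplus-unit-rhs-err₀ t) (negate α β ⟦ t ⟧))) (ℚ.neg-antimono-≤ ε≤t-α-β))
      where
      negate : ∀ α β c → α ℚ.+ β ℚ.- c ≡ ℚ.- (c ℚ.- (α ℚ.+ β))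
      negate = solve-∀ ℚ-ring

    probeForest-surplus : ∀ d N → surplus (forestTally false (probeSizes t d N) d) ℚ.≤ ℚ.- (⟦ N ⟧ ℚ.* ε)
    probeForest-surplus d zero    = ℚ.≤-reflexive (trans surplus-∅ (sym (vanish ε)))
      where
      vanish : ∀ ε → ℚ.- (ℚ.0ℚ ℚ.* ε) ≡ ℚ.0ℚ
      vanish = solve-∀ ℚ-ring
    probeForest-surplus d (suc N) = begin
      surplus (star ⊕ rest)            ≡⟨ surplus-⊕ star rest ⟩
      surplus star ℚ.+ surplus rest    ≤⟨ ℚ.+-mono-≤ (probeStar-surplus (d 0)) (probeForest-surplus (d ∘ suc) N) ⟩
      ℚ.- ε ℚ.+ ℚ.- (⟦ N ⟧ ℚ.* ε)      ≡⟨ grow ε ⟦ N ⟧ ⟩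
      ℚ.- ((ℚ.1ℚ ℚ.+ ⟦ N ⟧) ℚ.* ε)     ≡⟨ cong (λ n → ℚ.- (n ℚ.* ε)) (sym (⟦⟧-+ 1 N)) ⟩
      ℚ.- (⟦ suc N ⟧ ℚ.* ε)            ∎
      where
      open ℚ.≤-Reasoning
      star rest : Tally
      star = starTally false (starSize t false (d 0)) (d 0)
      rest   = forestTally false (probeSizes t (d ∘ suc) N) (d ∘ suc)
      grow : ∀ ε n → ℚ.- ε ℚ.+ ℚ.- (n ℚ.* ε) ≡ ℚ.- ((ℚ.1ℚ ℚ.+ n) ℚ.* ε)
      grow = solve-∀ ℚ-ring

  module _ {t} (1≤t : 1 ≤ t) (t≤α+β : ⟦ t ⟧ ℚ.≤ α ℚ.+ β) (α≤t : α ℚ.≤ ⟦ t ⟧) (0≤γ : ℚ.0ℚ ℚ.≤ γ) where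

    simulation-≼ : ∀ d I → forestTally true (starSizesFor t d I) d ≼ asgTally t I (guesses d I)
    simulation-≼ d [] = ≼-refl
    simulation-≼ d ((u , false , x) ∷ I) = subst (forestTally true (starSizesFor t d I) d ≼_)
      (sym (asgTally-∷ t u false x I false (guesses d I)))
      (⊕-mono-≼ (∅≼guess0-unpredicted t t≤α+β x) (simulation-≼ d I))
    simulation-≼ d ((u , true , x) ∷ I) = subst (forestTally true (starSizesFor t d ((u , true , x) ∷ I)) d ≼_)
      (sym (asgTally-∷ t u true x I (d 0) (guesses (d ∘ suc) I)))
      (⊕-mono-≼ (star≼request 1≤t α≤t 0≤γ x (d 0)) (simulation-≼ (d ∘ suc) I))

  ∅≼guess0 : ∀ t → ⟦ t ⟧ ℚ.≤ α → ℚ.0ℚ ℚ.≤ β → ℚ.0ℚ ℚ.≤ γ →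
    ∀ I → ∅ ≼ asgTally t I (map (λ _ → false) (inputs I))
  ∅≼guess0 t t≤α 0≤β 0≤γ [] = ≼-refl
  ∅≼guess0 t t≤α 0≤β 0≤γ ((u , p , x) ∷ I) = subst (∅ ≼_)
    (sym (asgTally-∷ t u p x I false (map (λ _ → false) (inputs I))))
    (⊕-mono-≼ (guess0-request p x) (∅≼guess0 t t≤α 0≤β 0≤γ I))
    where
    guess0-request : ∀ p x → ∅ ≼ requestTally t p x false
    guess0-request false = ∅≼guess0-unpredicted t (ℚ.≤-trans t≤α (p≤p+q α 0≤β))
    guess0-request true  = ∅≼guess0-predicted t t≤α 0≤γ

guess0-competitive : ∀ t {α β γ} → NonNeg3 α β γ → ⟦ t ⟧ ℚ.≤ α → ASG-Competitive t α β γ (λ _ → false)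
guess0-competitive t {α} {β} {γ} nonNeg@(_ , 0≤β , 0≤γ) t≤α = nonNeg , ℚ.0ℚ , λ I →
  bound (subst (Bounded ℚ.0ℚ ∘ asgTally t I) (sym (runFrom-const false [] (inputs I)))
    (bounded-≼ bounded-∅ (∅≼guess0 t t≤α 0≤β 0≤γ I)))
  where open Surplus α β γ

module FromBDIS {t α β γ} {A : OnlineAlg (List ℕ)} (1≤t : 1 ≤ t) (competitive : BDIS-Competitive t α β γ A) where

  open Surplus α β γ

  private
    nonNeg : NonNeg3 α β γ
    nonNeg = proj₁ competitive
    b : ℚ
    b = proj₁ (proj₂ competitive)

  forest-bound : ∀ p ks → All (_≤ t) ks → Bounded b (forestTally p ks (centreDecision A p))
  forest-bound p ks ks≤t = bounded-mono nonNeg promise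
    (ℕ.≤-reflexive (sym (zeros-truth-starForest ks p d)))
    (ℕ.≤-trans (starForest-zeros≤ ks p z |z| independent)
      (ℕ.≤-reflexive (cong rhs (forestTally-cong p ks (run-starForest A p ks)))))
    (ℕ.≤-reflexive (μ₀-starForest ks p d))
    (ℕ.≤-reflexive (μ₁-starForest ks p d))
    where
    I : Instance (List ℕ)
    I = starForest p ks
    z : List Bool
    z = run A I
    d : ℕ → Bool
    d = centreDecision A p
    valid : ValidBDIS t I
    valid = starForest-valid ks p 1≤t ks≤t
    promise : Bounded b (tally (zeros (truth I)) (zeros z) (μ₀ I) (μ₁ I))
    promise = mkBounded (proj₂ (proj₂ (proj₂ competitive) I valid))
    independent : IndependentZeros (starRequests (length ks) (leafCentres ks)) z
    independent = subst (λ rs → IndependentZeros rs z) (requests-starForest p ks)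
      (proj₁ (proj₂ (proj₂ competitive) I valid))
    |z| : length z ≡ length (starRequests (length ks) (leafCentres ks))
    |z| = trans (length-run A I) (trans (sym (length-map proj₁ I)) (cong length (requests-starForest p ks)))

  -- Each probe star loses at least ε = min(1, t − (α + β)) of surplus, so N of them,
  -- with N ε > b, would violate the bound.
  α+β≮t : ¬ (α ℚ.+ β ℚ.< ⟦ t ⟧)
  α+β≮t α+β<t = ℚ.<-irrefl refl (begin-strict
    ℚ.- b                   ≤⟨ bounded⇒-b≤surplus (forest-bound false (probeSizes t d N) sizes≤t) ⟩
    surplus probe           ≤⟨ probeForest-surplus 1≤t (ℚ.p⊓q≤p ℚ.1ℚ δ) (ℚ.p⊓q≤q ℚ.1ℚ δ) d N ⟩
    ℚ.- (⟦ N ⟧ ℚ.* ε)       <⟨ ℚ.neg-antimono-< b<Nε ⟩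
    ℚ.- b                   ∎)
    where
    open ℚ.≤-Reasoning
    δ ε : ℚ
    δ = ⟦ t ⟧ ℚ.- (α ℚ.+ β)
    ε = ℚ.1ℚ ℚ.⊓ δ
    0<ε : ℚ.0ℚ ℚ.< ε
    0<ε = Sum.[ (λ ε≡1 → subst (ℚ.0ℚ ℚ.<_) (sym ε≡1) (ℚ.positive⁻¹ ℚ.1ℚ))
          , (λ ε≡δ → subst (ℚ.0ℚ ℚ.<_) (sym ε≡δ) (p<q⇒0<q-p α+β<t)) ]′ (ℚ.⊓-sel ℚ.1ℚ δ)
    N : ℕ
    N = proj₁ (archimedean b ε 0<ε)
    b<Nε : b ℚ.< ⟦ N ⟧ ℚ.* ε
    b<Nε = proj₂ (archimedean b ε 0<ε)
    d : ℕ → Bool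
    d = centreDecision A false
    sizes≤t : All (_≤ t) (probeSizes t d N)
    sizes≤t = applyUpTo⁺₁ (starSize t false ∘ d) N (λ {i} _ → starSize≤ 1≤t false (d i))
    probe : Tally
    probe = forestTally false (probeSizes t d N) d

  t≤α+β : ⟦ t ⟧ ℚ.≤ α ℚ.+ β
  t≤α+β = ℚ.≮⇒≥ α+β≮t

  simulate-competitive : α ℚ.≤ ⟦ t ⟧ → ASG-Competitive t α β γ (simulate A)
  simulate-competitive α≤t = nonNeg , b , λ I →
    bound (subst (Bounded b ∘ asgTally t I) (sym (run-simulate A I))
      (bounded-≼ (forest-bound true (starSizesFor t d I) (starSizesFor-≤ 1≤t d I))
        (simulation-≼ 1≤t t≤α+β α≤t (proj₂ (proj₂ nonNeg)) d I)))
    where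
    d : ℕ → Bool
    d = centreDecision A true

lemma3p7 : (t : ℕ) → 1 ≤ t → (α β γ : ℚ) →
    Σ (OnlineAlg (List ℕ)) (λ A → BDIS-Competitive t α β γ A × BDIS-ParetoOptimal t α β γ) →
    Σ (OnlineAlg ⊤) (λ A → ASG-Competitive t α β γ A)
lemma3p7 t 1≤t α β γ (A , competitive , _) = Sum.[ guess0 , simulation ]′ (ℚ.≤-total ⟦ t ⟧ α)
  where
  guess0 : ⟦ t ⟧ ℚ.≤ α → Σ (OnlineAlg ⊤) (ASG-Competitive t α β γ)
  guess0 t≤α = (λ _ → false) , guess0-competitive t (proj₁ competitive) t≤α
  simulation : α ℚ.≤ ⟦ t ⟧ → Σ (OnlineAlg ⊤) (ASG-Competitive t α β γ)
  simulation α≤t = simulate A , FromBDIS.simulate-competitive 1≤t competitive α≤t
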